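{- Let $2\le k<g$ be integers such that $Y(g,k)$ is neither a complete Young graph nor a 1089 graph. Then every direct predecessor of $[0,0]$ in $Y(g,k)$ other than $[0,0]$ itself is an odd pivot node and not an even pivot node, and no direct successor of $[0,0]$ other than $[0,0]$ itself is an even pivot node.
   Context: For integers $2\le k<g$, the labeled directed graph $H(g,k)$ has a distinguished starting node $[[0,0]]$ and other nodes labeled by pairs $[R,r]$ of integers with $0\le R,r\le k-1$ (the node $[0,0]$ is distinct from the starting node). For a node $[P,p]$ (the starting node treated as $[0,0]$ here) there is an edge labeled $(A,a)$ from $[P,p]$ to $[R,r]$ whenever $0\le A,a\le g-1$ are integers, $0\le R,r\le k-1$, $ka+p=A+rg$ and $kA+R=a+Pg$; edges leaving the starting node additionally require $A\ne0\ne a$; no edge enters the starting node. $H(g,k)$ consists of the starting node and all nodes reachable from it. An even pivot node is a node $[a,a]$; an odd pivot node is a node $[r,s]$ with an edge to $[s,r]$ (including $[a,a]$ with a self-loop); the starting node is not a pivot node. $Y(g,k)$ is obtained from $H(g,k)$ by deleting every node that is not a pivot node and from which no pivot node is reachable, with incident edges. $Y(g,k)$ is a complete Young graph (on $m$ nodes) if its nodes other than the starting node are $m$ nodes forming the complete directed graph on them (an edge from each to each, including self-loops) and there is an edge from the starting node to every node except $[0,0]$. A 1089 graph is a Young graph isomorphic to $Y(10,9)$ via a bijection of nodes that is an isomorphism of underlying unlabeled directed graphs preserving even and odd pivot nodes; equivalently (by a result of the same paper) $(k+1)\mid g$. -}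

module Defs where

open import Data.Nat using (ℕ; _+_; _*_; _<_)
open import Data.Product using (Σ; ∃; _×_)
open import Data.Sum using (_⊎_)
open import Relation.Binary.PropositionalEquality using (_≡_; _≢_)
open import Relation.Binary.Construct.Closure.ReflexiveTransitive using (Star)
open import Function.Bundles using (_⇔_)

-- Nodes of H(g,k): the distinguished starting node [[0,0]] and pairs [R,r].
-- (The bounds 0 ≤ R,r ≤ k-1 are enforced by the edge relation; every node
-- reachable from the starting node satisfies them.)
data Node : Set where
  start : Node
  [_,_] : ℕ → ℕ → Node

-- Labelled edges of H(g,k); the label (A,a) is the first two arguments.
-- The starting node is treated as [0,0]; edges out of it need A ≠ 0 ≠ a;
-- no edge enters the starting node.
data HEdge (g k : ℕ) : Node → Node → Set where
  fromPair : ∀ {P p R r} (A a : ℕ) → A < g → a < g → R < k → r < k →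
             k * a + p ≡ A + r * g → k * A + R ≡ a + P * g →
             HEdge g k [ P , p ] [ R , r ]
  fromStart : ∀ {R r} (A a : ℕ) → A < g → a < g → R < k → r < k →
              A ≢ 0 → a ≢ 0 →
              k * a + 0 ≡ A + r * g → k * A + R ≡ a + 0 * g →
              HEdge g k start [ R , r ]

Reach : ℕ → ℕ → Node → Node → Set
Reach g k = Star (HEdge g k)

InH : ℕ → ℕ → Node → Set
InH g k v = Reach g k start v

EvenPivot : ℕ → ℕ → Node → Set
EvenPivot g k v = InH g k v × ∃ λ a → v ≡ [ a , a ]

OddPivot : ℕ → ℕ → Node → Set
OddPivot g k v = InH g k v × Σ ℕ λ r → Σ ℕ λ s → v ≡ [ r , s ] × HEdge g k [ r , s ] [ s , r ]

Pivot : ℕ → ℕ → Node → Set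
Pivot g k v = EvenPivot g k v ⊎ OddPivot g k v

InY : ℕ → ℕ → Node → Set
InY g k v = InH g k v × (Pivot g k v ⊎ ∃ λ w → Pivot g k w × Reach g k v w)

EdgeY : ℕ → ℕ → Node → Node → Set
EdgeY g k u v = InY g k u × InY g k v × HEdge g k u v

CompleteYoung : ℕ → ℕ → Set
CompleteYoung g k =
  (∀ u v → InY g k u → InY g k v → u ≢ start → v ≢ start → EdgeY g k u v) ×
  (∀ v → InY g k v → v ≢ start → v ≢ [ 0 , 0 ] → EdgeY g k start v)

record YIso (g k g' k' : ℕ) : Set where
  field
    to      : Node → Node
    from    : Node → Node
    to-in   : ∀ v → InY g k v → InY g' k' (to v)
    from-in : ∀ v → InY g' k' v → InY g k (from v)
    from-to : ∀ v → InY g k v → from (to v) ≡ v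
    to-from : ∀ v → InY g' k' v → to (from v) ≡ v
    edge    : ∀ u v → InY g k u → InY g k v → EdgeY g k u v ⇔ EdgeY g' k' (to u) (to v)
    even    : ∀ v → InY g k v → EvenPivot g k v ⇔ EvenPivot g' k' (to v)
    odd     : ∀ v → InY g k v → OddPivot g k v ⇔ OddPivot g' k' (to v)

Graph1089 : ℕ → ℕ → Set
Graph1089 g k = YIso g k 10 9

module Submission where

-- Everything rests on the digit equations  k·a + p = A + r·g  and
-- k·A + R = a + P·g  of an edge [P,p] → [R,r] labelled (A,a).  They are
-- symmetric under reversing an edge, and they let us prove:
--  * Completeness criterion: an edge [0,0] → [t,t] with t ≠ 0 makes Y(g,k)
--    complete.  With M = k² - 1 and T = g - k, every node is then a diagonal
--    node [s,s] with M ∣ s·T, and any two such nodes are joined by an edge.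
--  * 1089 criterion: if (k+1) ∣ g then Y(g,k) consists of the start and the
--    four corners [x,y], x,y ∈ {0,k-1}, with an edge pattern independent of
--    (g,k); hence it is isomorphic to Y(10,9).  The coordinates of H(g,k) then
--    follow a linear recurrence modulo k-1 (module Recurrence), which pins
--    down the pivots and everything from which a pivot is reachable.
-- The corollary follows: an even predecessor or successor of [0,0] yields a
-- diagonal edge out of [0,0]; a predecessor [P,p] has an edge to [p,P]
-- labelled by the sum of its labels, unless that sum forces (k+1) ∣ g.

open import Defs
open import Data.Nat using (ℕ; _≤_; _<_)
open import Data.Product using (_×_)
open import Relation.Nullary using (¬_)
open import Relation.Binary.PropositionalEquality using (_≢_)

open import Data.Bool using (Bool; true; false)
open import Data.Empty using (⊥; ⊥-elim)
open import Data.List using (_∷_; [])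
open import Data.Product using (Σ; ∃; _,_; proj₁; proj₂)
open import Data.Sum using (_⊎_; inj₁; inj₂)
open import Data.Unit using (⊤; tt)
open import Function.Bundles using (_⇔_; mk⇔)
import Function.Properties.Equivalence as ⇔
open import Relation.Nullary using (yes; no)
open import Relation.Binary.PropositionalEquality
  using (_≡_; refl; sym; trans; cong; cong₂; subst; subst₂; module ≡-Reasoning)
open import Relation.Binary.Construct.Closure.ReflexiveTransitive using (ε; _◅_; _◅◅_)

-- The recurrence  c·(u + w) ≡ v  (mod m)  and the walks it generates from
-- (0,0).  For (k+1) ∣ g the coordinates of H(g,k) follow it modulo k-1; the
-- key fact (walk-closed) is that a pair (u,v) reached together with its
-- reversal (v,u) consists of multiples of m.
module Recurrence where
  import Data.Nat as ℕ
  import Data.Nat.Properties as ℕ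
  import Data.Nat.Divisibility as ℕ
  import Data.Nat.GCD as ℕ
  import Data.Nat.Coprimality as ℕ
  open import Data.Nat.Induction using (<-rec)
  open import Data.Integer using (ℤ; +_; 0ℤ; _+_; _-_; _*_; -_)
  import Data.Integer as ℤ
  import Data.Integer.Properties as ℤ
  open import Data.Integer.Divisibility.Signed
  open import Data.Integer.Coprimality using (Coprime; coprime-divisor)
  open import Data.Integer.Tactic.RingSolver using (solve-∀)

  data ZWalk (m c : ℤ) : ℤ → ℤ → Set where
    origin : ZWalk m c 0ℤ 0ℤ
    step   : ∀ {u v w} → ZWalk m c u v → m ∣ v - c * (u + w) → ZWalk m c v w

  ∣0ℤ : ∀ {m} → m ∣ 0ℤ
  ∣0ℤ {m} = divides 0ℤ (sym (ℤ.*-zeroˡ m))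

  walk-coprime : ∀ {m c u v} → Coprime m c → ZWalk m c u v → m ∣ u × m ∣ v
  walk-coprime cop origin = ∣0ℤ , ∣0ℤ
  walk-coprime {m} {c} cop (step {u} {v} {w} walk m∣) =
    m∣v , ∣ᵤ⇒∣ (coprime-divisor m c w cop (∣⇒∣ᵤ (subst (m ∣_) (cw c u v w) m∣cw)))
    where
    m∣u : m ∣ u
    m∣u = proj₁ (walk-coprime cop walk)
    m∣v : m ∣ v
    m∣v = proj₂ (walk-coprime cop walk)
    m∣cw : m ∣ (v - (v - c * (u + w))) - c * u
    m∣cw = ∣m∣n⇒∣m-n (∣m∣n⇒∣m-n m∣v m∣) (∣n⇒∣m*n c m∣u)
    cw : ∀ c u v w → (v - (v - c * (u + w))) - c * u ≡ c * w
    cw = solve-∀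

  walk-first : ∀ {d m c u v} → d ∣ m → d ∣ c → ZWalk m c u v → d ∣ u
  walk-first d∣m d∣c origin = ∣0ℤ
  walk-first {d} {c = c} d∣m d∣c (step {u} {v} {w} _ m∣) =
    subst (d ∣_) (split c u v w) (∣m∣n⇒∣m+n (∣-trans d∣m m∣) (∣m⇒∣m*n (u + w) d∣c))
    where
    split : ∀ c u v w → (v - c * (u + w)) + c * (u + w) ≡ v
    split = solve-∀

  walk-divide : ∀ {d m c u v x y} .{{_ : ℤ.NonZero d}} → d ∣ c →
                ZWalk (d * m) c u v → u ≡ d * x → v ≡ d * y → ZWalk m c x y
  walk-divide {d} {m} {c} {x = x} {y} d∣c origin 0≡dx 0≡dy =
    subst₂ (ZWalk m c) (vanish 0≡dx) (vanish 0≡dy) origin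
    where
    vanish : ∀ {z} → 0ℤ ≡ d * z → 0ℤ ≡ z
    vanish {z} 0≡dz = ℤ.*-cancelˡ-≡ d 0ℤ z (trans (ℤ.*-zeroʳ d) 0≡dz)
  walk-divide {d} {m} {c} {x = x} {y} d∣c (step {u} {v} {w} walk dm∣) v≡dx w≡dy
    with walk-first (∣m⇒∣m*n m ∣-refl) d∣c walk
  ... | divides q u≡qd =
    step (walk-divide d∣c walk (trans u≡qd (ℤ.*-comm q d)) v≡dx)
         (*-cancelˡ-∣ d (subst (d * m ∣_) factor dm∣))
    where
    factor : v - c * (u + w) ≡ d * (x - c * (q + y))
    factor = begin
      v - c * (u + w)              ≡⟨ cong₂ (λ s t → s - c * t) v≡dx (cong₂ _+_ u≡qd w≡dy) ⟩
      d * x - c * (q * d + d * y)  ≡⟨ pull d c x q y ⟩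
      d * (x - c * (q + y))        ∎
      where
      open ≡-Reasoning
      pull : ∀ d c x q y → d * x - c * (q * d + d * y) ≡ d * (x - c * (q + y))
      pull = solve-∀

  Closed : ℕ → ℕ → Set
  Closed m c = ∀ {u v} → ZWalk (+ m) (+ c) u v → ZWalk (+ m) (+ c) v u → + m ∣ u × + m ∣ v

  closed-by-divisor : ∀ {m c q d} .{{_ : ℕ.NonZero d}} → m ≡ q ℕ.* d → d ℕ.∣ c → Closed q c → Closed m c
  closed-by-divisor {m} {c} {q} {d} m≡qd d∣c closed {u} {v} walk walk′ =
    multiply u≡dx (proj₁ reduced) , multiply v≡dy (proj₂ reduced)
    where
    m≡dq : + m ≡ + d * + q
    m≡dq = trans (cong +_ (trans m≡qd (ℕ.*-comm q d))) (ℤ.pos-* d q)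
    d∣m : + d ∣ + m
    d∣m = divides (+ q) (trans m≡dq (ℤ.*-comm (+ d) (+ q)))
    d∣c′ : + d ∣ + c
    d∣c′ = ∣ᵤ⇒∣ d∣c
    x y : ℤ
    x = _∣_.quotient (walk-first d∣m d∣c′ walk)
    y = _∣_.quotient (walk-first d∣m d∣c′ walk′)
    u≡dx : u ≡ + d * x
    u≡dx = trans (_∣_.equality (walk-first d∣m d∣c′ walk)) (ℤ.*-comm x (+ d))
    v≡dy : v ≡ + d * y
    v≡dy = trans (_∣_.equality (walk-first d∣m d∣c′ walk′)) (ℤ.*-comm y (+ d))
    reduced : + q ∣ x × + q ∣ y
    reduced = closed (walk-divide d∣c′ (subst (λ M → ZWalk M (+ c) u v) m≡dq walk) u≡dx v≡dy)
                     (walk-divide d∣c′ (subst (λ M → ZWalk M (+ c) v u) m≡dq walk′) v≡dy u≡dx)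
    multiply : ∀ {z t} → z ≡ + d * t → + q ∣ t → + m ∣ z
    multiply z≡dt q∣t = subst₂ _∣_ (sym m≡dq) (sym z≡dt) (*-monoʳ-∣ (+ d) q∣t)

  -- Every modulus m ≠ 0 is closed, by strong induction on m: if gcd(m,c) = 1
  -- use walk-coprime, otherwise divide by the gcd.
  walk-closed-ℤ : ∀ m c → m ≢ 0 → Closed m c
  walk-closed-ℤ m c = <-rec (λ m → m ≢ 0 → Closed m c) closed-step m
    where
    closed-step : ∀ m → (∀ {n} → n ℕ.< m → n ≢ 0 → Closed n c) → m ≢ 0 → Closed m c
    closed-step m rec m≢0 with ℕ.gcd m c ℕ.≟ 1
    ... | yes gcd≡1 = λ walk _ → walk-coprime (ℕ.gcd≡1⇒coprime gcd≡1) walk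
    ... | no gcd≢1 with ℕ.gcd[m,n]∣m m c
    ...   | ℕ.divides q m≡qd =
      closed-by-divisor {{ℕ.≢-nonZero d≢0}} m≡qd (ℕ.gcd[m,n]∣n m c) (rec q<m q≢0)
      where
      d≢0 : ℕ.gcd m c ≢ 0
      d≢0 = ℕ.gcd[m,n]≢0 m c (inj₁ m≢0)
      q≢0 : q ≢ 0
      q≢0 refl = m≢0 m≡qd
      1<d : ∀ {d} → d ≢ 0 → d ≢ 1 → 1 ℕ.< d
      1<d {0} d≢0 _ = ⊥-elim (d≢0 refl)
      1<d {1} _ d≢1 = ⊥-elim (d≢1 refl)
      1<d {ℕ.suc (ℕ.suc _)} _ _ = ℕ.s≤s (ℕ.s≤s ℕ.z≤n)
      q<m : q ℕ.< m
      q<m = subst (q ℕ.<_) (sym m≡qd) (ℕ.m<m*n q _ {{ℕ.≢-nonZero q≢0}} (1<d d≢0 gcd≢1))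

  Walk : ℕ → ℕ → ℕ → ℕ → Set
  Walk m c u v = ZWalk (+ m) (+ c) (+ u) (+ v)

  Linked : ℕ → ℕ → ℕ → ℕ → ℕ → Set
  Linked m c u v w = + m ∣ + v - + c * (+ u + + w)

  linked : ∀ {m c u v w i j} → v ℕ.+ m ℕ.* i ≡ c ℕ.* (u ℕ.+ w) ℕ.+ m ℕ.* j → Linked m c u v w
  linked {m} {c} {u} {v} {w} {i} {j} eq = divides (+ j - + i) (difference {+ v} {+ c * (+ u + + w)} {+ m} {+ i} {+ j} lifted)
    where
    lifted : + v + + m * + i ≡ + c * (+ u + + w) + + m * + j
    lifted = begin
      + v + + m * + i                      ≡⟨ cong (λ z → + v + z) (ℤ.pos-* m i) ⟨
      + v + + (m ℕ.* i)                    ≡⟨ ℤ.pos-+ v (m ℕ.* i) ⟨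
      + (v ℕ.+ m ℕ.* i)                    ≡⟨ cong +_ eq ⟩
      + (c ℕ.* (u ℕ.+ w) ℕ.+ m ℕ.* j)      ≡⟨ ℤ.pos-+ (c ℕ.* (u ℕ.+ w)) (m ℕ.* j) ⟩
      + (c ℕ.* (u ℕ.+ w)) + + (m ℕ.* j)    ≡⟨ cong₂ _+_ (ℤ.pos-* c (u ℕ.+ w)) (ℤ.pos-* m j) ⟩
      + c * + (u ℕ.+ w) + + m * + j        ≡⟨ cong (λ z → + c * z + + m * + j) (ℤ.pos-+ u w) ⟩
      + c * (+ u + + w) + + m * + j        ∎
      where open ≡-Reasoning
    difference : ∀ {V X M I J} → V + M * I ≡ X + M * J → V - X ≡ (J - I) * M
    difference {V} {X} {M} {I} {J} e = begin
      V - X                          ≡⟨ shift V X M I ⟩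
      (V + M * I) - (X + M * I)      ≡⟨ cong (_- (X + M * I)) e ⟩
      (X + M * J) - (X + M * I)      ≡⟨ collect X M I J ⟩
      (J - I) * M                    ∎
      where
      open ≡-Reasoning
      shift : ∀ V X M I → V - X ≡ (V + M * I) - (X + M * I)
      shift = solve-∀
      collect : ∀ X M I J → (X + M * J) - (X + M * I) ≡ (J - I) * M
      collect = solve-∀

  walk-closed : ∀ {m c u v} → m ≢ 0 → Walk m c u v → Walk m c v u → m ℕ.∣ u × m ℕ.∣ v
  walk-closed {m} {c} m≢0 walk walk′ =
    ∣⇒∣ᵤ (proj₁ (walk-closed-ℤ m c m≢0 walk walk′)) , ∣⇒∣ᵤ (proj₂ (walk-closed-ℤ m c m≢0 walk walk′))

  walk-reversed : ∀ {m c u v w} → m ℕ.∣ v → m ℕ.∣ w → Linked m c u v w → Walk m c v u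
  walk-reversed {m} {c} {u} {v} {w} m∣v m∣w link = step (step origin first) second
    where
    negate : ∀ c v → - (c * v) ≡ 0ℤ - c * (0ℤ + v)
    negate = solve-∀
    drop : ∀ c u v w → (v - c * (u + w)) + c * w ≡ v - c * (0ℤ + u)
    drop = solve-∀
    first : + m ∣ 0ℤ - + c * (0ℤ + + v)
    first = subst (+ m ∣_) (negate (+ c) (+ v)) (∣m⇒∣-m (∣n⇒∣m*n (+ c) (∣ᵤ⇒∣ m∣v)))
    second : + m ∣ + v - + c * (0ℤ + + u)
    second = subst (+ m ∣_) (drop (+ c) (+ u) (+ v) (+ w)) (∣m∣n⇒∣m+n link (∣n⇒∣m*n (+ c) (∣ᵤ⇒∣ m∣w)))

open import Data.Nat using (zero; suc; _+_; _*_; _%_; z≤n; s≤s; NonZero; >-nonZero)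
open import Data.Nat.Properties
open import Data.Nat.DivMod using (m<n⇒m%n≡m; [m+kn]%n≡m%n)
open import Data.Nat.Divisibility using (_∣_; divides; ∣-refl; ∣m+n∣m⇒∣n; ∣m∣n⇒∣m+n; m∣m*n; ∣n⇒∣m*n)
open import Data.Nat.Tactic.RingSolver using (solve; solve-∀)
open Recurrence using (Walk; Linked; origin; step; linked; walk-closed; walk-reversed)

congruent-below : ∀ {m x y} i j .{{_ : NonZero m}} →
                  x + i * m ≡ y + j * m → x < m → y < m → x ≡ y
congruent-below {m} {x} {y} i j eq x<m y<m = begin
  x                ≡⟨ m<n⇒m%n≡m x<m ⟨
  x % m            ≡⟨ [m+kn]%n≡m%n x i m ⟨
  (x + i * m) % m  ≡⟨ cong (_% m) eq ⟩
  (y + j * m) % m  ≡⟨ [m+kn]%n≡m%n y j m ⟩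
  y % m            ≡⟨ m<n⇒m%n≡m y<m ⟩
  y                ∎
  where open ≡-Reasoning

multiple-below : ∀ {m P} → m ∣ P → P ≤ m → P ≡ 0 ⊎ P ≡ m
multiple-below (divides zero P≡0) _ = inj₁ P≡0
multiple-below {m} {P} (divides (suc q) P≡m+qm) P≤m = inj₂ (begin
  P          ≡⟨ P≡m+qm ⟩
  m + q * m  ≡⟨ cong (m +_) (n≤0⇒n≡0 qm≤0) ⟩
  m + 0      ≡⟨ +-identityʳ m ⟩
  m          ∎)
  where
  open ≡-Reasoning
  qm≤0 : q * m ≤ 0
  qm≤0 = +-cancelˡ-≤ m (q * m) 0 (subst₂ _≤_ P≡m+qm (sym (+-identityʳ m)) P≤m)

-- The digit equations of an edge of H(g,k) labelled (A,a) from [P,p] to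
-- [R,r]; an edge out of the starting node satisfies them with [P,p] = [0,0].
record Digits (g k P p R r A a : ℕ) : Set where
  constructor digits
  field
    equation₁ : k * a + p ≡ A + r * g
    equation₂ : k * A + R ≡ a + P * g

eliminate-A : ∀ {g k P p R r A a} → Digits g k P p R r A a →
              k * k * a + k * p + R ≡ a + (P + k * r) * g
eliminate-A {g} {k} {P} {p} {R} {r} {A} {a} (digits e₁ e₂) = begin
  k * k * a + k * p + R    ≡⟨ solve (k ∷ a ∷ p ∷ R ∷ []) ⟩
  k * (k * a + p) + R      ≡⟨ cong (λ n → k * n + R) e₁ ⟩
  k * (A + r * g) + R      ≡⟨ solve (k ∷ A ∷ r ∷ g ∷ R ∷ []) ⟩
  (k * A + R) + k * r * g  ≡⟨ cong (_+ k * r * g) e₂ ⟩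
  a + P * g + k * r * g    ≡⟨ solve (a ∷ P ∷ g ∷ k ∷ r ∷ []) ⟩
  a + (P + k * r) * g      ∎
  where open ≡-Reasoning

reverse-edge : ∀ {g k P p R r} → P < k → p < k →
               HEdge g k [ P , p ] [ R , r ] → HEdge g k [ r , R ] [ p , P ]
reverse-edge P<k p<k (fromPair A a A<g a<g _ _ e₁ e₂) = fromPair a A a<g A<g p<k P<k e₂ e₁

origin-digits : ∀ {g k₂ p R A a} → Digits g (2 + k₂) 0 p R 0 A a → a ≡ 0 × p ≡ 0
origin-digits {g} {k₂} {p} {R} {A} {a} eqs =
  m*n≡0⇒m≡0 a (3 + k₂ * (4 + k₂)) (m+n≡0⇒m≡0 (a * (3 + k₂ * (4 + k₂))) first-two) ,
  m*n≡0⇒m≡0 p (2 + k₂) (m+n≡0⇒n≡0 (a * (3 + k₂ * (4 + k₂))) first-two)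
  where
  open ≡-Reasoning
  rest : a * (3 + k₂ * (4 + k₂)) + p * (2 + k₂) + R ≡ 0
  rest = +-cancelˡ-≡ a _ 0 (begin
    a + (a * (3 + k₂ * (4 + k₂)) + p * (2 + k₂) + R)  ≡⟨ solve (a ∷ k₂ ∷ p ∷ R ∷ []) ⟩
    (2 + k₂) * (2 + k₂) * a + (2 + k₂) * p + R        ≡⟨ eliminate-A eqs ⟩
    a + (2 + k₂) * 0 * g                              ≡⟨ cong (λ n → a + n * g) (*-zeroʳ (2 + k₂)) ⟩
    a + 0                                             ∎)
  first-two : a * (3 + k₂ * (4 + k₂)) + p * (2 + k₂) ≡ 0
  first-two = m+n≡0⇒m≡0 (a * (3 + k₂ * (4 + k₂)) + p * (2 + k₂)) rest

-- For k ≥ 2 there is no edge [k-1,0] → [0,k-1]: its labels would be a = A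
-- and then (k-1)·a = (k-1)·g, although a < g.
no-return-across : ∀ {g k₂ A a} → Digits g (2 + k₂) (suc k₂) 0 0 (suc k₂) A a → a < g → ⊥
no-return-across {g} {k₂} {A} {a} (digits e₁ e₂) = <-irrefl a≡g
  where
  open ≡-Reasoning
  a≡A : a ≡ A
  a≡A = *-cancelˡ-≡ a A (3 + k₂) (begin
    (3 + k₂) * a             ≡⟨ solve (k₂ ∷ a ∷ []) ⟩
    a + ((2 + k₂) * a + 0)   ≡⟨ cong (a +_) e₁ ⟩
    a + (A + suc k₂ * g)     ≡⟨ solve (a ∷ A ∷ k₂ ∷ g ∷ []) ⟩
    A + (a + suc k₂ * g)     ≡⟨ cong (A +_) e₂ ⟨
    A + ((2 + k₂) * A + 0)   ≡⟨ solve (A ∷ k₂ ∷ []) ⟩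
    (3 + k₂) * A             ∎)
  a≡g : a ≡ g
  a≡g = *-cancelˡ-≡ a g (suc k₂) (+-cancelˡ-≡ a _ _ (begin
    a + suc k₂ * a           ≡⟨ solve (a ∷ k₂ ∷ []) ⟩
    (2 + k₂) * a + 0         ≡⟨ e₁ ⟩
    A + suc k₂ * g           ≡⟨ cong (_+ suc k₂ * g) a≡A ⟨
    a + suc k₂ * g           ∎))

sum-digits : ∀ {g k P p A a} → Digits g k P p 0 0 A a → Digits g k P p p P (A + a) (A + a)
sum-digits {g} {k} {P} {p} {A} {a} (digits e₁ e₂) = digits sum-eq sum-eq
  where
  open ≡-Reasoning
  sum-eq : k * (A + a) + p ≡ (A + a) + P * g
  sum-eq = begin
    k * (A + a) + p            ≡⟨ solve (k ∷ A ∷ a ∷ p ∷ []) ⟩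
    (k * A + 0) + (k * a + p)  ≡⟨ cong₂ _+_ e₂ e₁ ⟩
    (a + P * g) + (A + 0)      ≡⟨ solve (a ∷ P ∷ g ∷ A ∷ []) ⟩
    (A + a) + P * g            ∎

-- If the summed label is not a digit (A + a ≥ g), then g = (k+1)·a: squeezing
-- P·g ≤ (k-1)·g ≤ (k-1)·(A + a) ≤ (k-1)·(A + a) + p = P·g forces p = 0 and
-- g = A + a, and then A = k·a.
large-sum : ∀ {g k₂ P p A a} → P < 2 + k₂ → g ≤ A + a →
            Digits g (2 + k₂) P p 0 0 A a → g ≡ (3 + k₂) * a
large-sum {g} {k₂} {P} {p} {A} {a} P<k g≤s eqs = begin
  g                  ≡⟨ g≡s ⟩
  A + a              ≡⟨ cong (_+ a) A≡ka ⟩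
  (2 + k₂) * a + a   ≡⟨ solve (k₂ ∷ a ∷ []) ⟩
  (3 + k₂) * a       ∎
  where
  open ≡-Reasoning
  s k₁ : ℕ
  s = A + a
  k₁ = suc k₂
  balance : k₁ * s + p ≡ P * g
  balance = +-cancelˡ-≡ s _ _ (trans (sym (+-assoc s (k₁ * s) p)) (Digits.equation₁ (sum-digits eqs)))
  Pg≤k₁g : P * g ≤ k₁ * g
  Pg≤k₁g = *-monoˡ-≤ g (≤-pred P<k)
  k₁g≡k₁s : k₁ * g ≡ k₁ * s
  k₁g≡k₁s = ≤-antisym (*-monoʳ-≤ k₁ g≤s)
    (≤-trans (m≤m+n (k₁ * s) p) (subst (_≤ k₁ * g) (sym balance) Pg≤k₁g))
  g≡s : g ≡ s
  g≡s = *-cancelˡ-≡ g s k₁ k₁g≡k₁s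
  p≡0 : p ≡ 0
  p≡0 = n≤0⇒n≡0 (+-cancelˡ-≤ (k₁ * s) p 0
    (subst₂ _≤_ (sym balance) (trans k₁g≡k₁s (sym (+-identityʳ _))) Pg≤k₁g))
  A≡ka : A ≡ (2 + k₂) * a
  A≡ka = sym (begin
    (2 + k₂) * a       ≡⟨ +-identityʳ _ ⟨
    (2 + k₂) * a + 0   ≡⟨ cong ((2 + k₂) * a +_) p≡0 ⟨
    (2 + k₂) * a + p   ≡⟨ Digits.equation₁ eqs ⟩
    A + 0              ≡⟨ +-identityʳ A ⟩
    A                  ∎)

predecessor-loop : ∀ {g k₂ P p} → P < 2 + k₂ → p < 2 + k₂ →
                   HEdge g (2 + k₂) [ P , p ] [ 0 , 0 ] →
                   HEdge g (2 + k₂) [ P , p ] [ p , P ] ⊎ ∃ λ a → g ≡ (3 + k₂) * a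
predecessor-loop {g} {k₂} {P} {p} P<k p<k (fromPair A a _ _ _ _ e₁ e₂) with A + a <? g
... | yes s<g = inj₁ (fromPair (A + a) (A + a) s<g s<g p<k P<k (Digits.equation₁ loop) (Digits.equation₂ loop))
  where
  loop : Digits g (2 + k₂) P p p P (A + a) (A + a)
  loop = sum-digits (digits e₁ e₂)
... | no s≮g = inj₂ (a , large-sum P<k (≮⇒≥ s≮g) (digits e₁ e₂))

propagate : ∀ {g k} {I : Node → Set} → (∀ {u v} → I u → HEdge g k u v → I v) →
            ∀ {u v} → I u → Reach g k u v → I v
propagate next i ε = i
propagate next i (e ◅ path) = propagate next (next i e) path

extend : ∀ {g k u v w} → Reach g k u v → HEdge g k v w → Reach g k u w
extend path e = path ◅◅ (e ◅ ε)

InRange : ℕ → Node → Set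
InRange k start = ⊤
InRange k [ P , p ] = P < k × p < k

inH-bounds : ∀ {g k P p} → InH g k [ P , p ] → P < k × p < k
inH-bounds {g} {k} = propagate in-range tt
  where
  in-range : ∀ {u v} → InRange k u → HEdge g k u v → InRange k v
  in-range _ (fromPair _ _ _ _ R<k r<k _ _) = R<k , r<k
  in-range _ (fromStart _ _ _ _ R<k r<k _ _ _ _) = R<k , r<k

inY-backward : ∀ {g k u v} → InH g k u → HEdge g k u v → InY g k v → InY g k u
inY-backward hu e (_ , inj₁ pivot) = hu , inj₂ (_ , pivot , e ◅ ε)
inY-backward hu e (_ , inj₂ (w , pivot , path)) = hu , inj₂ (w , pivot , e ◅ path)

-- Fix k, T = g - k ≥ 1 and M = k² - 1 (so k·k = M + 1).
-- A digit s is good if M ∣ s·T.  From a good diagonal source every edge leads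
-- to a good diagonal target, given one good digit r₀ with 0 < r₀ < k; and any
-- two good diagonal nodes are joined by an edge.
module Completeness (k T M : ℕ) .{{_ : NonZero T}} .{{_ : NonZero M}}
                    (square : k * k ≡ suc M) where

  open ≤-Reasoning hiding (start)

  digits-below : ∀ {x y} → x < k → y < k → k * x + y ≤ M
  digits-below {x} {y} x<k y<k = ≤-pred (begin-strict
    k * x + y   <⟨ +-monoʳ-< (k * x) y<k ⟩
    k * x + k   ≡⟨ solve (k ∷ x ∷ []) ⟩
    k * suc x   ≤⟨ *-monoʳ-≤ k x<k ⟩
    k * k       ≡⟨ square ⟩
    suc M       ∎)

  product-below : ∀ {x y} → 0 < x → x < k → y < k → x * y < M
  product-below {x} {y} 0<x x<k y<k = begin-strict
    x * y       <⟨ m<m+n (x * y) 0<x ⟩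
    x * y + x   ≡⟨ solve (x ∷ y ∷ []) ⟩
    x * suc y   ≤⟨ *-monoʳ-≤ x y<k ⟩
    x * k       ≡⟨ *-comm x k ⟩
    k * x       ≤⟨ m≤m+n (k * x) y ⟩
    k * x + y   ≤⟨ digits-below x<k y<k ⟩
    M           ∎

  diagonal-identity : ∀ {P R r A a} → Digits (k + T) k P P R r A a →
                      M * a + R ≡ P * T + M * r + r + k * r * T
  diagonal-identity {P} {R} {r} {A} {a} eqs = +-cancelˡ-≡ (a + k * P) _ _ (begin-equality
    a + k * P + (M * a + R)                      ≡⟨ solve (a ∷ k ∷ P ∷ M ∷ R ∷ []) ⟩
    suc M * a + k * P + R                        ≡⟨ cong (λ n → n * a + k * P + R) square ⟨
    k * k * a + k * P + R                        ≡⟨ eliminate-A eqs ⟩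
    a + (P + k * r) * (k + T)                    ≡⟨ solve (a ∷ P ∷ k ∷ r ∷ T ∷ []) ⟩
    a + k * P + (P * T + k * k * r + k * r * T)  ≡⟨ cong (λ n → a + k * P + (P * T + n * r + k * r * T)) square ⟩
    a + k * P + (P * T + suc M * r + k * r * T)  ≡⟨ solve (a ∷ k ∷ P ∷ T ∷ M ∷ r ∷ []) ⟩
    a + k * P + (P * T + M * r + r + k * r * T)  ∎)

  -- Given a good digit r₀ ≠ 0, an edge out of a good diagonal node ends on the
  -- diagonal: multiplied by r₀, the identity above says r₀·R ≡ r₀·r (mod M).
  target-diagonal : ∀ {r₀ P R r A a} → M ∣ r₀ * T → 0 < r₀ → r₀ < k → M ∣ P * T →
                    R < k → r < k → Digits (k + T) k P P R r A a → R ≡ r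
  target-diagonal {r₀} {P} {R} {r} {A} {a} (divides v r₀T≡vM) 0<r₀ r₀<k (divides u PT≡uM) R<k r<k eqs =
    *-cancelˡ-≡ R r r₀ {{>-nonZero 0<r₀}}
      (congruent-below (r₀ * a) (r₀ * u + r₀ * r + k * r * v) congruence
                       (product-below 0<r₀ r₀<k R<k) (product-below 0<r₀ r₀<k r<k))
    where
    congruence : r₀ * R + r₀ * a * M ≡ r₀ * r + (r₀ * u + r₀ * r + k * r * v) * M
    congruence = begin-equality
      r₀ * R + r₀ * a * M
        ≡⟨ solve (r₀ ∷ R ∷ a ∷ M ∷ []) ⟩
      r₀ * (M * a + R)
        ≡⟨ cong (r₀ *_) (diagonal-identity eqs) ⟩
      r₀ * (P * T + M * r + r + k * r * T)
        ≡⟨ solve (r₀ ∷ P ∷ T ∷ M ∷ r ∷ k ∷ []) ⟩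
      r₀ * r + r₀ * (P * T) + r₀ * r * M + k * r * (r₀ * T)
        ≡⟨ cong₂ (λ x y → r₀ * r + r₀ * x + r₀ * r * M + k * r * y) PT≡uM r₀T≡vM ⟩
      r₀ * r + r₀ * (u * M) + r₀ * r * M + k * r * (v * M)
        ≡⟨ solve (r₀ ∷ r ∷ u ∷ M ∷ k ∷ v ∷ []) ⟩
      r₀ * r + (r₀ * u + r₀ * r + k * r * v) * M ∎

  -- A diagonal target of a good diagonal node is good: the identity gives
  -- M ∣ k·r·T, and k·(k·r·T) = M·r·T + r·T.
  target-good : ∀ {P r A a} → M ∣ P * T → Digits (k + T) k P P r r A a → M ∣ r * T
  target-good {P} {r} {A} {a} M∣PT eqs =
    ∣m+n∣m⇒∣n (subst (M ∣_) expand (∣n⇒∣m*n k M∣krT)) (m∣m*n (r * T))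
    where
    Ma≡ : M * a ≡ P * T + M * r + k * r * T
    Ma≡ = +-cancelʳ-≡ r (M * a) (P * T + M * r + k * r * T) (begin-equality
      M * a + r                         ≡⟨ diagonal-identity eqs ⟩
      P * T + M * r + r + k * r * T     ≡⟨ solve (P ∷ T ∷ M ∷ r ∷ k ∷ []) ⟩
      P * T + M * r + k * r * T + r     ∎)
    M∣krT : M ∣ k * r * T
    M∣krT = ∣m+n∣m⇒∣n (subst (M ∣_) Ma≡ (m∣m*n a)) (∣m∣n⇒∣m+n M∣PT (m∣m*n r))
    expand : k * (k * r * T) ≡ M * (r * T) + r * T
    expand = begin-equality
      k * (k * r * T)      ≡⟨ solve (k ∷ r ∷ T ∷ []) ⟩
      k * k * (r * T)      ≡⟨ cong (_* (r * T)) square ⟩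
      suc M * (r * T)      ≡⟨ solve (M ∷ r ∷ T ∷ []) ⟩
      M * (r * T) + r * T  ∎

  -- Edges between good diagonal nodes [s,s] → [t,t], where s·T = u·M and
  -- t·T = w·M: the labels A = s + w + k·u and a = t + k·w + u work.
  diagonal-equation : ∀ {s t u w} → t * T ≡ w * M →
                      k * (t + k * w + u) + s ≡ (s + w + k * u) + t * (k + T)
  diagonal-equation {s} {t} {u} {w} tT≡wM = begin-equality
    k * (t + k * w + u) + s         ≡⟨ solve (k ∷ t ∷ w ∷ u ∷ s ∷ []) ⟩
    k * t + k * k * w + k * u + s   ≡⟨ cong (λ n → k * t + n * w + k * u + s) square ⟩
    k * t + suc M * w + k * u + s   ≡⟨ solve (k ∷ t ∷ M ∷ w ∷ u ∷ s ∷ []) ⟩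
    s + w + k * u + t * k + w * M   ≡⟨ cong (s + w + k * u + t * k +_) tT≡wM ⟨
    s + w + k * u + t * k + t * T   ≡⟨ solve (s ∷ w ∷ k ∷ u ∷ t ∷ T ∷ []) ⟩
    (s + w + k * u) + t * (k + T)   ∎

  diagonal-digits : ∀ {s t u w} → s * T ≡ u * M → t * T ≡ w * M →
                    Digits (k + T) k s s t t (s + w + k * u) (t + k * w + u)
  diagonal-digits {s} {t} {u} {w} sT≡uM tT≡wM = digits (diagonal-equation tT≡wM) (begin-equality
    k * (s + w + k * u) + t          ≡⟨ solve (k ∷ s ∷ w ∷ u ∷ t ∷ []) ⟩
    k * (s + k * u + w) + t          ≡⟨ diagonal-equation sT≡uM ⟩
    (t + u + k * w) + s * (k + T)    ≡⟨ solve (t ∷ u ∷ k ∷ w ∷ s ∷ T ∷ []) ⟩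
    (t + k * w + u) + s * (k + T)    ∎)

  -- The labels are digits: M·(k·w + u) = (k·t + s)·T ≤ M·T.
  label-below : ∀ {s t u w} → s * T ≡ u * M → t * T ≡ w * M → s < k → t < k →
                t + k * w + u < k + T
  label-below {s} {t} {u} {w} sT≡uM tT≡wM s<k t<k =
    subst (_< k + T) (sym (+-assoc t (k * w) u)) (+-mono-<-≤ t<k kw+u≤T)
    where
    kw+u≤T : k * w + u ≤ T
    kw+u≤T = *-cancelˡ-≤ M (begin
      M * (k * w + u)       ≡⟨ solve (M ∷ k ∷ w ∷ u ∷ []) ⟩
      k * (w * M) + u * M   ≡⟨ cong₂ (λ x y → k * x + y) tT≡wM sT≡uM ⟨
      k * (t * T) + s * T   ≡⟨ solve (k ∷ t ∷ T ∷ s ∷ []) ⟩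
      (k * t + s) * T       ≤⟨ *-monoˡ-≤ T (digits-below t<k s<k) ⟩
      M * T                 ∎)

  other-label-below : ∀ {s t u w} → s * T ≡ u * M → t * T ≡ w * M → s < k → t < k →
                      s + w + k * u < k + T
  other-label-below {s} {t} {u} {w} sT≡uM tT≡wM s<k t<k =
    subst (_< k + T) reorder (label-below tT≡wM sT≡uM t<k s<k)
    where
    reorder : s + k * u + w ≡ s + w + k * u
    reorder = solve (s ∷ k ∷ u ∷ w ∷ [])

  diagonal-edge : ∀ {s t} → M ∣ s * T → M ∣ t * T → s < k → t < k →
                  HEdge (k + T) k [ s , s ] [ t , t ]
  diagonal-edge {s} {t} (divides u sT≡uM) (divides w tT≡wM) s<k t<k =
    fromPair _ _ (other-label-below sT≡uM tT≡wM s<k t<k) (label-below sT≡uM tT≡wM s<k t<k) t<k t<k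
             (Digits.equation₁ eqs) (Digits.equation₂ eqs)
    where
    eqs : Digits (k + T) k s s t t (s + w + k * u) (t + k * w + u)
    eqs = diagonal-digits sT≡uM tT≡wM

  -- The same labels with s = u = 0 give an edge from the start to [t,t] for t ≠ 0.
  start-edge : ∀ {t} → M ∣ t * T → t < k → t ≢ 0 → HEdge (k + T) k start [ t , t ]
  start-edge {t} (divides w tT≡wM) t<k t≢0 =
    fromStart _ _ (other-label-below refl tT≡wM 0<k t<k) (label-below refl tT≡wM 0<k t<k) t<k t<k
              A≢0 a≢0 (Digits.equation₁ eqs) (Digits.equation₂ eqs)
    where
    0<k : 0 < k
    0<k = ≤-trans (s≤s z≤n) t<k
    eqs : Digits (k + T) k 0 0 t t (w + k * 0) (t + k * w + 0)
    eqs = diagonal-digits refl tT≡wM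
    A≢0 : w + k * 0 ≢ 0
    A≢0 A≡0 = t≢0 (m*n≡0⇒m≡0 t T (trans tT≡wM (cong (_* M) (m+n≡0⇒m≡0 w A≡0))))
    a≢0 : t + k * w + 0 ≢ 0
    a≢0 a≡0 = t≢0 (m+n≡0⇒m≡0 t (m+n≡0⇒m≡0 (t + k * w) a≡0))

  -- Given a good digit 0 < r₀ < k, every node of H(k+T,k) is the start or a
  -- good diagonal node, so Y(k+T,k) is complete.
  module _ {r₀} (M∣r₀T : M ∣ r₀ * T) (0<r₀ : 0 < r₀) (r₀<k : r₀ < k) where

    data Good : Node → Set where
      at-start : Good start
      diagonal : ∀ {s} → s < k → M ∣ s * T → Good [ s , s ]

    arrive : ∀ {P R r A a} → M ∣ P * T → R < k → r < k → Digits (k + T) k P P R r A a → Good [ R , r ]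
    arrive M∣PT R<k r<k eqs with target-diagonal M∣r₀T 0<r₀ r₀<k M∣PT R<k r<k eqs
    ... | refl = diagonal R<k (target-good M∣PT eqs)

    good-step : ∀ {u v} → Good u → HEdge (k + T) k u v → Good v
    good-step at-start (fromStart _ _ _ _ R<k r<k _ _ e₁ e₂) = arrive (divides 0 refl) R<k r<k (digits e₁ e₂)
    good-step (diagonal _ M∣sT) (fromPair _ _ _ _ R<k r<k e₁ e₂) = arrive M∣sT R<k r<k (digits e₁ e₂)

    good : ∀ {v} → InH (k + T) k v → Good v
    good = propagate good-step at-start

    complete : CompleteYoung (k + T) k
    complete = all-edges , start-edges
      where
      all-edges : ∀ u v → InY (k + T) k u → InY (k + T) k v → u ≢ start → v ≢ start →
                  EdgeY (k + T) k u v
      all-edges u v iu iv u≢start v≢start with good (proj₁ iu) | good (proj₁ iv)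
      ... | at-start | _ = ⊥-elim (u≢start refl)
      ... | _ | at-start = ⊥-elim (v≢start refl)
      ... | diagonal s<k M∣sT | diagonal t<k M∣tT = iu , iv , diagonal-edge M∣sT M∣tT s<k t<k
      start-edges : ∀ v → InY (k + T) k v → v ≢ start → v ≢ [ 0 , 0 ] → EdgeY (k + T) k start v
      start-edges v iv v≢start v≢00 with good (proj₁ iv)
      ... | at-start = ⊥-elim (v≢start refl)
      ... | diagonal {t} t<k M∣tT = inY-backward ε e iv , iv , e
        where
        e : HEdge (k + T) k start [ t , t ]
        e = start-edge M∣tT t<k (λ { refl → v≢00 refl })

  complete-from-edge : ∀ {t} → HEdge (k + T) k [ 0 , 0 ] [ t , t ] → t ≢ 0 → CompleteYoung (k + T) k
  complete-from-edge (fromPair _ _ _ _ t<k _ e₁ e₂) t≢0 =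
    complete (target-good (divides 0 refl) (digits e₁ e₂)) (n≢0⇒n>0 t≢0) t<k

complete-if-diagonal-edge : ∀ {g k₂ t} → 2 + k₂ < g → HEdge g (2 + k₂) [ 0 , 0 ] [ t , t ] → t ≢ 0 →
                            CompleteYoung g (2 + k₂)
complete-if-diagonal-edge {g} {k₂} {t} k<g e t≢0 =
  subst (λ g → CompleteYoung g k) g≡k+T
    (C.complete-from-edge (subst (λ g → HEdge g k [ 0 , 0 ] [ t , t ]) (sym g≡k+T) e) t≢0)
  where
  k T₀ : ℕ
  k = 2 + k₂
  T₀ = proj₁ (m≤n⇒∃[o]m+o≡n k<g)
  g≡k+T : k + suc T₀ ≡ g
  g≡k+T = trans (+-suc k T₀) (proj₂ (m≤n⇒∃[o]m+o≡n k<g))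
  square : (2 + k₂) * (2 + k₂) ≡ suc (suc k₂ * (3 + k₂))
  square = solve (k₂ ∷ [])
  module C = Completeness k (suc T₀) (suc k₂ * (3 + k₂)) square

-- Modulo k+1 the
-- eliminated digit equation reads R ≡ p; dividing it by k+1 leaves
-- (k-1)·a + p = (P + k·r)·c.
divisible-core : ∀ {k₁ c P p R r A a} → Digits (suc (suc k₁) * c) (suc k₁) P p R r A a →
                 R < suc k₁ → p < suc k₁ → R ≡ p × Linked k₁ c P p r
divisible-core {k₁} {c} {P} {p} {R} {r} {A} {a} eqs R<k p<k = R≡p , linked {k₁} {c} {P} {p} {r} {a} {c * r} reduced
  where
  open ≡-Reasoning
  congruence : R + (k₁ * a + p) * (2 + k₁) ≡ p + ((P + suc k₁ * r) * c) * (2 + k₁)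
  congruence = +-cancelˡ-≡ a _ _ (begin
    a + (R + (k₁ * a + p) * (2 + k₁))            ≡⟨ solve (a ∷ R ∷ k₁ ∷ p ∷ []) ⟩
    suc k₁ * suc k₁ * a + suc k₁ * p + R + p     ≡⟨ cong (_+ p) (eliminate-A eqs) ⟩
    a + (P + suc k₁ * r) * ((2 + k₁) * c) + p    ≡⟨ solve (a ∷ P ∷ k₁ ∷ r ∷ c ∷ p ∷ []) ⟩
    a + (p + ((P + suc k₁ * r) * c) * (2 + k₁))  ∎)
  R≡p : R ≡ p
  R≡p = congruent-below (k₁ * a + p) ((P + suc k₁ * r) * c) congruence
                        (m≤n⇒m≤1+n R<k) (m≤n⇒m≤1+n p<k)
  quotient-eq : k₁ * a + p ≡ (P + suc k₁ * r) * c
  quotient-eq = *-cancelʳ-≡ _ _ (2 + k₁) (+-cancelˡ-≡ p _ _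
    (subst (λ x → x + (k₁ * a + p) * (2 + k₁) ≡ p + ((P + suc k₁ * r) * c) * (2 + k₁)) R≡p congruence))
  reduced : p + k₁ * a ≡ c * (P + r) + k₁ * (c * r)
  reduced = begin
    p + k₁ * a                   ≡⟨ +-comm p (k₁ * a) ⟩
    k₁ * a + p                   ≡⟨ quotient-eq ⟩
    (P + suc k₁ * r) * c         ≡⟨ solve (P ∷ k₁ ∷ r ∷ c ∷ []) ⟩
    c * (P + r) + k₁ * (c * r)   ∎

-- The common shape of all Y(g,k) with (k+1) ∣ g: the start and the four
-- corners [x,y] with digits x, y ∈ {0, k-1}, a corner coded by two booleans.
data Shape : Set where
  initial : Shape
  corner  : Bool → Bool → Shape

-- Edges of the shape: from the start only to [0,k-1]; between corners
-- [x,y] → [y,z] exactly when x = y or y = z (the two zig-zags are missing).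
data ShapeEdge : Shape → Shape → Set where
  launch     : ShapeEdge initial (corner false true)
  stay-left  : ∀ y z → ShapeEdge (corner y y) (corner y z)
  stay-right : ∀ x y → ShapeEdge (corner x y) (corner y y)

-- The diagonal corners: these are both the even and the odd pivots.
data ShapeDiagonal : Shape → Set where
  diagonal : ∀ x → ShapeDiagonal (corner x x)

reversal-diagonal : ∀ {x y} → ShapeEdge (corner x y) (corner y x) → ShapeDiagonal (corner x y)
reversal-diagonal (stay-left y _) = diagonal y
reversal-diagonal (stay-right x _) = diagonal x

-- A corner coordinate as a digit, m = k - 1 being the top digit.
digit : ℕ → Bool → ℕ
digit m false = 0
digit m true  = m

shape-node : ℕ → Shape → Node
shape-node m initial      = start
shape-node m (corner x y) = [ digit m x , digit m y ]

relabel : ℕ → Node → Node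
relabel m start     = start
relabel m [ x , y ] = [ rescale x , rescale y ]
  where
  rescale : ℕ → ℕ
  rescale zero    = zero
  rescale (suc _) = m

relabel-shape : ∀ m n φ → relabel (suc m) (shape-node (suc n) φ) ≡ shape-node (suc m) φ
relabel-shape m n initial = refl
relabel-shape m n (corner false false) = refl
relabel-shape m n (corner false true)  = refl
relabel-shape m n (corner true  false) = refl
relabel-shape m n (corner true  true)  = refl

module Divisible (k₂ c₁ : ℕ) where

  k₁ k c g : ℕ
  k₁ = suc k₂
  k  = suc k₁
  c  = suc c₁
  g  = suc k * c

  node : Shape → Node
  node = shape-node k₁

  InShape : Node → Set
  InShape v = Σ Shape λ φ → v ≡ node φ

  0<k : 0 < k
  0<k = s≤s z≤n

  digit<k : ∀ x → digit k₁ x < k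
  digit<k false = 0<k
  digit<k true  = n<1+n k₁

  digit-injective : ∀ {x y} → digit k₁ x ≡ digit k₁ y → x ≡ y
  digit-injective {false} {false} _ = refl
  digit-injective {false} {true}  ()
  digit-injective {true}  {false} ()
  digit-injective {true}  {true}  _ = refl

  k₁∣digit : ∀ x → k₁ ∣ digit k₁ x
  k₁∣digit false = divides 0 refl
  k₁∣digit true  = ∣-refl

  digit-of : ∀ {P} → k₁ ∣ P → P < k → Σ Bool λ x → P ≡ digit k₁ x
  digit-of k₁∣P P<k with multiple-below k₁∣P (≤-pred P<k)
  ... | inj₁ P≡0  = false , P≡0
  ... | inj₂ P≡k₁ = true , P≡k₁

  corner-of : ∀ {P p} → k₁ ∣ P → k₁ ∣ p → P < k → p < k → InShape [ P , p ]
  corner-of k₁∣P k₁∣p P<k p<k with digit-of k₁∣P P<k | digit-of k₁∣p p<k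
  ... | x , refl | y , refl = corner x y , refl

  -- Besides the two loops, the
  -- edges [0,0] → [0,k-1] (labels c, k·c; also out of the start) and
  -- [0,k-1] → [k-1,k-1] (labels c-1, k·(c-1) + k-1) suffice; the remaining
  -- ones are their reversals.
  c<g : c < g
  c<g = m<m+n c (s≤s z≤n)

  rise-digits : Digits g k 0 0 0 k₁ c (k * c)
  rise-digits = digits (rise-identity k₂ c₁) refl
    where
    rise-identity : ∀ k₂ c₁ → (2 + k₂) * ((2 + k₂) * suc c₁) + 0 ≡ suc c₁ + suc k₂ * ((3 + k₂) * suc c₁)
    rise-identity = solve-∀

  launch-edge : HEdge g k start [ 0 , k₁ ]
  launch-edge = fromStart c (k * c) c<g (m<n+m (k * c) (s≤s z≤n)) 0<k (n<1+n k₁) (λ ()) (λ ())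
                          (Digits.equation₁ rise-digits) (Digits.equation₂ rise-digits)

  rise-edge : HEdge g k [ 0 , 0 ] [ 0 , k₁ ]
  rise-edge = fromPair c (k * c) c<g (m<n+m (k * c) (s≤s z≤n)) 0<k (n<1+n k₁)
                       (Digits.equation₁ rise-digits) (Digits.equation₂ rise-digits)

  climb-edge : HEdge g k [ 0 , k₁ ] [ k₁ , k₁ ]
  climb-edge = fromPair c₁ (k * c₁ + k₁) (<-trans (n<1+n c₁) c<g) a<g (n<1+n k₁) (n<1+n k₁)
                        (climb-identity k₂ c₁) (sym (+-identityʳ (k * c₁ + k₁)))
    where
    climb-identity : ∀ k₂ c₁ → (2 + k₂) * ((2 + k₂) * c₁ + suc k₂) + suc k₂ ≡ c₁ + suc k₂ * ((3 + k₂) * suc c₁)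
    climb-identity = solve-∀
    g-split : ∀ k₂ c₁ → (3 + k₂) * suc c₁ ≡ ((2 + k₂) * c₁ + suc k₂) + suc (suc c₁)
    g-split = solve-∀
    a<g : k * c₁ + k₁ < g
    a<g = subst (k * c₁ + k₁ <_) (sym (g-split k₂ c₁)) (m<m+n (k * c₁ + k₁) (s≤s z≤n))

  loop-zero : HEdge g k [ 0 , 0 ] [ 0 , 0 ]
  loop-zero = fromPair 0 0 (s≤s z≤n) (s≤s z≤n) 0<k 0<k zero-eq zero-eq
    where
    zero-eq : k * 0 + 0 ≡ 0 + 0 * g
    zero-eq = trans (+-identityʳ (k * 0)) (*-zeroʳ k)

  -- the loop at [k-1,k-1] is labelled (g-1, g-1)
  loop-top : HEdge g k [ k₁ , k₁ ] [ k₁ , k₁ ]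
  loop-top = fromPair top top top<g top<g (n<1+n k₁) (n<1+n k₁) (top-identity k₂ c₁) (top-identity k₂ c₁)
    where
    top : ℕ
    top = k + suc k * c₁
    top-identity : ∀ k₂ c₁ → (2 + k₂) * ((2 + k₂) + (3 + k₂) * c₁) + suc k₂ ≡
                             ((2 + k₂) + (3 + k₂) * c₁) + suc k₂ * ((3 + k₂) * suc c₁)
    top-identity = solve-∀
    g-split : ∀ k₂ c₁ → (3 + k₂) * suc c₁ ≡ suc ((2 + k₂) + (3 + k₂) * c₁)
    g-split = solve-∀
    top<g : top < g
    top<g = subst (top <_) (sym (g-split k₂ c₁)) (n<1+n top)

  stay-left-edge : ∀ y z → HEdge g k (node (corner y y)) (node (corner y z))
  stay-left-edge false false = loop-zero
  stay-left-edge false true  = rise-edge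
  stay-left-edge true  false = reverse-edge 0<k (n<1+n k₁) climb-edge
  stay-left-edge true  true  = loop-top

  shape-edge : ∀ {φ ψ} → ShapeEdge φ ψ → HEdge g k (node φ) (node ψ)
  shape-edge launch           = launch-edge
  shape-edge (stay-left y z)  = stay-left-edge y z
  shape-edge (stay-right x y) = reverse-edge (digit<k y) (digit<k y) (stay-left-edge y x)

  -- Conversely every edge of H(g,k) between shape nodes is an edge of the
  -- shape: by divisible-core an edge [x,y] → [y′,z] has y′ = y, the zig-zag
  -- [0,k-1] → [k-1,0] contradicts origin-digits, and [k-1,0] → [0,k-1]
  -- contradicts no-return-across.
  corner-edge : ∀ {A a} x y z → a < g → Digits g k (digit k₁ x) (digit k₁ y) (digit k₁ y) (digit k₁ z) A a →
                ShapeEdge (corner x y) (corner y z)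
  corner-edge false false z _ _ = stay-left false z
  corner-edge true  true  z _ _ = stay-left true z
  corner-edge x false false _ _ = stay-right x false
  corner-edge x true  true  _ _ = stay-right x true
  corner-edge false true false _ eqs with proj₂ (origin-digits eqs)
  ... | ()
  corner-edge true false true a<g eqs = ⊥-elim (no-return-across eqs a<g)

  launch-target : ∀ {A a} y z → a ≢ 0 → Digits g k 0 0 (digit k₁ y) (digit k₁ z) A a →
                  ShapeEdge initial (corner y z)
  launch-target y z a≢0 eqs with digit-injective {y} {false} (proj₁ (divisible-core {k₁} {c} eqs (digit<k y) 0<k))
  launch-target _ false a≢0 eqs | refl = ⊥-elim (a≢0 (proj₁ (origin-digits eqs)))
  launch-target _ true  _   _   | refl = launch

  corner-target : ∀ {A a} x y y′ z → a < g → Digits g k (digit k₁ x) (digit k₁ y) (digit k₁ y′) (digit k₁ z) A a →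
                  ShapeEdge (corner x y) (corner y′ z)
  corner-target x y y′ z a<g eqs with digit-injective {y′} {y} (proj₁ (divisible-core {k₁} {c} eqs (digit<k y′) (digit<k y)))
  ... | refl = corner-edge x y z a<g eqs

  classify-edge : ∀ {φ ψ} → HEdge g k (node φ) (node ψ) → ShapeEdge φ ψ
  classify-edge {initial} {corner y z} (fromStart _ _ _ _ _ _ _ a≢0 e₁ e₂) = launch-target y z a≢0 (digits e₁ e₂)
  classify-edge {corner x y} {corner y′ z} (fromPair _ _ _ a<g _ _ e₁ e₂) = corner-target x y y′ z a<g (digits e₁ e₂)

  inH-0m : InH g k [ 0 , k₁ ]
  inH-mm : InH g k [ k₁ , k₁ ]
  inH-m0 : InH g k [ k₁ , 0 ]
  inH-00 : InH g k [ 0 , 0 ]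
  inH-0m = extend ε launch-edge
  inH-mm = extend inH-0m climb-edge
  inH-m0 = extend inH-mm (shape-edge (stay-left true false))
  inH-00 = extend inH-m0 (shape-edge (stay-right true false))

  shape-inH : ∀ φ → InH g k (node φ)
  shape-inH initial              = ε
  shape-inH (corner false false) = inH-00
  shape-inH (corner false true)  = inH-0m
  shape-inH (corner true  false) = inH-m0
  shape-inH (corner true  true)  = inH-mm

  even-of-diagonal : ∀ {φ} → ShapeDiagonal φ → EvenPivot g k (node φ)
  even-of-diagonal (diagonal x) = shape-inH (corner x x) , digit k₁ x , refl

  odd-of-diagonal : ∀ {φ} → ShapeDiagonal φ → OddPivot g k (node φ)
  odd-of-diagonal (diagonal x) = shape-inH (corner x x) , digit k₁ x , digit k₁ x , refl , stay-left-edge x x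

  shape-inY : ∀ φ → InY g k (node φ)
  shape-inY φ = shape-inH φ , reaches-pivot φ
    where
    pivot : ∀ x → Pivot g k (node (corner x x))
    pivot x = inj₁ (even-of-diagonal (diagonal x))
    reaches-pivot : ∀ φ → Pivot g k (node φ) ⊎ ∃ λ w → Pivot g k w × Reach g k (node φ) w
    reaches-pivot initial              = inj₂ (_ , pivot true , launch-edge ◅ climb-edge ◅ ε)
    reaches-pivot (corner false false) = inj₁ (pivot false)
    reaches-pivot (corner false true)  = inj₂ (_ , pivot true , climb-edge ◅ ε)
    reaches-pivot (corner true  false) = inj₂ (_ , pivot false , shape-edge (stay-right true false) ◅ ε)
    reaches-pivot (corner true  true)  = inj₁ (pivot true)

  -- Invariant of H(g,k): the coordinates of a pair node are digits and form a
  -- walk of the recurrence modulo k-1.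
  data Tracked : Node → Set where
    at-start : Tracked start
    tracked  : ∀ {P p} → P < k → p < k → Walk k₁ c P p → Tracked [ P , p ]

  arrive : ∀ {P p R r A a} → p < k → Walk k₁ c P p → R < k → r < k → Digits g k P p R r A a → Tracked [ R , r ]
  arrive p<k walk R<k r<k eqs with divisible-core {k₁} {c} eqs R<k p<k
  ... | refl , link = tracked R<k r<k (step walk link)

  track-step : ∀ {u v} → Tracked u → HEdge g k u v → Tracked v
  track-step at-start (fromStart _ _ _ _ R<k r<k _ _ e₁ e₂) = arrive 0<k origin R<k r<k (digits e₁ e₂)
  track-step (tracked _ p<k walk) (fromPair _ _ _ _ R<k r<k e₁ e₂) = arrive p<k walk R<k r<k (digits e₁ e₂)

  walk-of : ∀ {P p} → InH g k [ P , p ] → Walk k₁ c P p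
  walk-of h with propagate track-step at-start h
  ... | tracked _ _ walk = walk

  -- Pivots are diagonal corners: the walk reaches (P,p) and (p,P), so k-1
  -- divides both coordinates.
  pivot-shape : ∀ {v} → Pivot g k v → InShape v
  pivot-shape (inj₁ (h , a , refl)) = corner-of k₁∣a k₁∣a a<k a<k
    where
    a<k : a < k
    a<k = proj₁ (inH-bounds h)
    k₁∣a : k₁ ∣ a
    k₁∣a = proj₁ (walk-closed (λ ()) (walk-of h) (walk-of h))
  pivot-shape (inj₂ (h , r , s , refl , fromPair A a _ _ s<k r<k e₁ e₂)) =
    corner-of (proj₁ closed) (proj₂ closed) r<k s<k
    where
    eqs : Digits g k r s s r A a
    eqs = digits e₁ e₂
    closed : k₁ ∣ r × k₁ ∣ s
    closed = walk-closed (λ ()) (walk-of h) (step (walk-of h) (proj₂ (divisible-core {k₁} {c} eqs s<k s<k)))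

  -- A node of H(g,k) with an edge to a shape node is a shape node: for an edge
  -- [P,p] → [p,r] with p, r digits the walk also reaches (p,P).
  back-closure : ∀ {u ψ} → InH g k u → HEdge g k u (node ψ) → InShape u
  back-closure {ψ = initial} _ ()
  back-closure {ψ = corner y z} _ (fromStart _ _ _ _ _ _ _ _ _ _) = initial , refl
  back-closure {ψ = corner y z} h (fromPair {P} {p} A a _ _ R<k _ e₁ e₂) =
    corner-of (proj₂ closed) (proj₁ closed) (proj₁ bounds) (proj₂ bounds)
    where
    bounds : P < k × p < k
    bounds = inH-bounds h
    eqs : Digits g k P p (digit k₁ y) (digit k₁ z) A a
    eqs = digits e₁ e₂
    core : digit k₁ y ≡ p × Linked k₁ c P p (digit k₁ z)
    core = divisible-core {k₁} {c} eqs R<k (proj₂ bounds)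
    closed : k₁ ∣ p × k₁ ∣ P
    closed = walk-closed (λ ()) (walk-reversed (subst (k₁ ∣_) (proj₁ core) (k₁∣digit y)) (k₁∣digit z) (proj₂ core))
                         (walk-of h)

  reach-closure : ∀ {u v} → InH g k u → Reach g k u v → InShape v → InShape u
  reach-closure _ ε shape = shape
  reach-closure h (e ◅ path) shape with reach-closure (extend h e) path shape
  ... | _ , refl = back-closure h e

  classify-node : ∀ {v} → InY g k v → InShape v
  classify-node (_ , inj₁ pivot) = pivot-shape pivot
  classify-node (h , inj₂ (_ , pivot , path)) = reach-closure h path (pivot-shape pivot)

  edge-shape : ∀ {φ ψ} → EdgeY g k (node φ) (node ψ) ⇔ ShapeEdge φ ψ
  edge-shape {φ} {ψ} = mk⇔ (λ (_ , _ , e) → classify-edge e) (λ e → shape-inY φ , shape-inY ψ , shape-edge e)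

  even-shape : ∀ {φ} → EvenPivot g k (node φ) ⇔ ShapeDiagonal φ
  even-shape {φ} = mk⇔ (diagonal-of-even φ) even-of-diagonal
    where
    diagonal-of-even : ∀ φ → EvenPivot g k (node φ) → ShapeDiagonal φ
    diagonal-of-even initial (_ , _ , ())
    diagonal-of-even (corner x y) (_ , _ , eq) =
      subst (λ y → ShapeDiagonal (corner x y)) (digit-injective (trans (cong row eq) (sym (cong col eq)))) (diagonal x)
      where
      row col : Node → ℕ
      row start = 0
      row [ P , _ ] = P
      col start = 0
      col [ _ , p ] = p

  odd-shape : ∀ {φ} → OddPivot g k (node φ) ⇔ ShapeDiagonal φ
  odd-shape {φ} = mk⇔ (diagonal-of-odd φ) odd-of-diagonal
    where
    diagonal-of-odd : ∀ φ → OddPivot g k (node φ) → ShapeDiagonal φ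
    diagonal-of-odd initial (_ , _ , _ , () , _)
    diagonal-of-odd (corner x y) (_ , _ , _ , refl , e) = reversal-diagonal (classify-edge {corner x y} {corner y x} e)

shape-iso : ∀ k₂ c₁ k₂′ c₁′ → YIso (Divisible.g k₂ c₁) (Divisible.k k₂ c₁)
                                    (Divisible.g k₂′ c₁′) (Divisible.k k₂′ c₁′)
shape-iso k₂ c₁ k₂′ c₁′ = record
  { to      = to
  ; from    = from
  ; to-in   = λ _ iv → to-in (D.classify-node iv)
  ; from-in = λ _ iv → from-in (D′.classify-node iv)
  ; from-to = λ _ iv → from-to (D.classify-node iv)
  ; to-from = λ _ iv → to-from (D′.classify-node iv)
  ; edge    = λ _ _ iu iv → edge (D.classify-node iu) (D.classify-node iv)
  ; even    = λ _ iv → even (D.classify-node iv)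
  ; odd     = λ _ iv → odd (D.classify-node iv)
  }
  where
  module D  = Divisible k₂ c₁
  module D′ = Divisible k₂′ c₁′
  to from : Node → Node
  to   = relabel (suc k₂′)
  from = relabel (suc k₂)
  to-node : ∀ φ → D′.node φ ≡ to (D.node φ)
  to-node φ = sym (relabel-shape k₂′ k₂ φ)
  from-node : ∀ φ → D.node φ ≡ from (D′.node φ)
  from-node φ = sym (relabel-shape k₂ k₂′ φ)

  to-in : ∀ {v} → D.InShape v → InY D′.g D′.k (to v)
  to-in (φ , refl) = subst (InY D′.g D′.k) (to-node φ) (D′.shape-inY φ)
  from-in : ∀ {v} → D′.InShape v → InY D.g D.k (from v)
  from-in (φ , refl) = subst (InY D.g D.k) (from-node φ) (D.shape-inY φ)
  from-to : ∀ {v} → D.InShape v → from (to v) ≡ v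
  from-to (φ , refl) = sym (trans (from-node φ) (cong from (to-node φ)))
  to-from : ∀ {v} → D′.InShape v → to (from v) ≡ v
  to-from (φ , refl) = sym (trans (to-node φ) (cong to (from-node φ)))
  edge : ∀ {u v} → D.InShape u → D.InShape v → EdgeY D.g D.k u v ⇔ EdgeY D′.g D′.k (to u) (to v)
  edge (φ , refl) (ψ , refl) =
    subst₂ (λ u v → EdgeY D.g D.k (D.node φ) (D.node ψ) ⇔ EdgeY D′.g D′.k u v) (to-node φ) (to-node ψ)
      (⇔.trans D.edge-shape (⇔.sym D′.edge-shape))
  even : ∀ {v} → D.InShape v → EvenPivot D.g D.k v ⇔ EvenPivot D′.g D′.k (to v)
  even (φ , refl) = subst (λ v → EvenPivot D.g D.k (D.node φ) ⇔ EvenPivot D′.g D′.k v) (to-node φ)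
                      (⇔.trans D.even-shape (⇔.sym D′.even-shape))
  odd : ∀ {v} → D.InShape v → OddPivot D.g D.k v ⇔ OddPivot D′.g D′.k (to v)
  odd (φ , refl) = subst (λ v → OddPivot D.g D.k (D.node φ) ⇔ OddPivot D′.g D′.k v) (to-node φ)
                     (⇔.trans D.odd-shape (⇔.sym D′.odd-shape))

-- If (k+1) ∣ g, with 2 ≤ k < g, then Y(g,k) is a 1089 graph (Y(10,9) is the case k₂ = 7, c₁ = 0).
divisible-1089 : ∀ {g k₂ a} → 2 + k₂ < g → g ≡ (3 + k₂) * a → Graph1089 g (2 + k₂)
divisible-1089 {k₂ = k₂} {zero} k<g refl = ⊥-elim (n≮0 (subst (2 + k₂ <_) (*-zeroʳ (3 + k₂)) k<g))
divisible-1089 {k₂ = k₂} {suc c₁} _ refl = shape-iso k₂ c₁ 7 0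

no-diagonal-edge : ∀ {g k₂ t} → 2 + k₂ < g → ¬ CompleteYoung g (2 + k₂) →
                   HEdge g (2 + k₂) [ 0 , 0 ] [ t , t ] → [ t , t ] ≢ [ 0 , 0 ] → ⊥
no-diagonal-edge k<g not-complete e t,t≢0,0 =
  not-complete (complete-if-diagonal-edge k<g e (λ { refl → t,t≢0,0 refl }))

-- Hence an even predecessor [t,t] ≠ [0,0] of [0,0] is impossible: reversing
-- its edge gives [0,0] → [t,t].
not-even-predecessor : ∀ {g k₂ v} → 2 + k₂ < g → ¬ CompleteYoung g (2 + k₂) → InH g (2 + k₂) v →
                       HEdge g (2 + k₂) v [ 0 , 0 ] → v ≢ [ 0 , 0 ] → ¬ EvenPivot g (2 + k₂) v
not-even-predecessor {k₂ = k₂} k<g not-complete h e v≢0,0 (_ , t , refl) =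
  no-diagonal-edge k<g not-complete (reverse-edge t<k t<k e) v≢0,0
  where
  t<k : t < 2 + k₂
  t<k = proj₁ (inH-bounds h)

odd-predecessor : ∀ {g k₂ v} → 2 + k₂ < g → ¬ Graph1089 g (2 + k₂) → InH g (2 + k₂) v →
                  HEdge g (2 + k₂) v [ 0 , 0 ] → OddPivot g (2 + k₂) v
odd-predecessor {g} {k₂} _ _ _ (fromStart A a _ _ _ _ _ a≢0 e₁ e₂) = ⊥-elim (a≢0 (proj₁ (origin-digits eqs)))
  where
  eqs : Digits g (2 + k₂) 0 0 0 0 A a
  eqs = digits e₁ e₂
odd-predecessor {v = [ P , p ]} k<g not-1089 h e with predecessor-loop (proj₁ (inH-bounds h)) (proj₂ (inH-bounds h)) e
... | inj₁ loop = h , P , p , refl , loop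
... | inj₂ (a , g≡) = ⊥-elim (not-1089 (divisible-1089 {a = a} k<g g≡))

corollary7 : (g k : ℕ) → 2 ≤ k → k < g →
    ¬ CompleteYoung g k → ¬ Graph1089 g k →
    (∀ v → EdgeY g k v [ 0 , 0 ] → v ≢ [ 0 , 0 ] → OddPivot g k v × ¬ EvenPivot g k v) ×
    (∀ w → EdgeY g k [ 0 , 0 ] w → w ≢ [ 0 , 0 ] → ¬ EvenPivot g k w)
corollary7 g (suc (suc k₂)) (s≤s (s≤s z≤n)) k<g not-complete not-1089 = predecessors , successors
  where
  k : ℕ
  k = 2 + k₂
  predecessors : ∀ v → EdgeY g k v [ 0 , 0 ] → v ≢ [ 0 , 0 ] → OddPivot g k v × ¬ EvenPivot g k v
  predecessors _ (iv , _ , e) v≢0,0 =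
    odd-predecessor k<g not-1089 (proj₁ iv) e , not-even-predecessor k<g not-complete (proj₁ iv) e v≢0,0
  successors : ∀ w → EdgeY g k [ 0 , 0 ] w → w ≢ [ 0 , 0 ] → ¬ EvenPivot g k w
  successors _ (_ , _ , e) w≢0,0 (_ , _ , refl) = no-diagonal-edge k<g not-complete e w≢0,0
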